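{- For all nonnegative integers $n,\ell,k$ with $\ell<n-k$, \[\operatorname{ldim}\big(Q_n^{\ell,(n-k)}\big)\le 2+\max\{\ell,k\}.\]
   Context: For $0\le a<b\le n$, $Q_n^{a,b}$ denotes the poset consisting of all $a$-element and all $b$-element subsets of $[n]$, ordered by inclusion. For a poset $P=(X,\le)$, a partial linear extension is a linear order $L=(Y,\le_L)$ with $Y\subseteq X$ such that $x\le y$ implies $x\le_L y$ for $x,y\in Y$. A local realiser is a set $\mathcal{L}$ of partial linear extensions such that for every ordered pair $(x,y)$ with $x\not\ge y$ some $L\in\mathcal{L}$ contains both and has $x\le_L y$. The multiplicity $\mu_{\mathcal{L}}(x)$ is the number of members of $\mathcal{L}$ containing $x$; the local dimension $\operatorname{ldim}(P)$ is the minimum over local realisers of $\max_x\mu_{\mathcal{L}}(x)$. -}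

module Defs where

open import Data.Nat using (ℕ; _≤_)
open import Data.Bool using (Bool)
import Data.Bool as B
open import Data.Fin using (Fin; toℕ)
open import Data.Fin.Subset using (Subset; _⊆_; ∣_∣)
open import Data.Vec.Properties using (≡-dec)
open import Data.List using (List; length; lookup; filter)
open import Data.List.Relation.Unary.All using (All)
open import Data.List.Relation.Unary.Any using (any?)
open import Data.List.Relation.Unary.Unique.Propositional using (Unique)
open import Data.List.Membership.Propositional using (_∈_)
open import Data.Product using (Σ; ∃; _×_; _,_)
open import Data.Sum using (_⊎_)
open import Relation.Binary.PropositionalEquality using (_≡_)
open import Relation.Nullary using (¬_; Dec)

_≟ˢ_ : ∀ {n} (x y : Subset n) → Dec (x ≡ y)
_≟ˢ_ = ≡-dec B._≟_

-- Ground set of Q_n^{a,b}: the a-element and b-element subsets of [n] = Fin n.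
-- The order of Q_n^{a,b} is inclusion _⊆_.
InQ : (n a b : ℕ) → Subset n → Set
InQ n a b s = ∣ s ∣ ≡ a ⊎ ∣ s ∣ ≡ b

-- A partial linear extension of Q_n^{a,b}: a finite linear order on a subset Y
-- of the ground set, represented as a duplicate-free list (earlier = smaller),
-- such that x ⊆ y implies x comes no later than y.
record PLE (n a b : ℕ) : Set where
  field
    elems    : List (Subset n)
    inQ      : All (InQ n a b) elems
    distinct : Unique elems
    monotone : ∀ (i j : Fin (length elems)) →
               lookup elems i ⊆ lookup elems j → toℕ i ≤ toℕ j
open PLE public

_≤[_]_ : ∀ {n a b} → Subset n → PLE n a b → Subset n → Set
x ≤[ L ] y = Σ (Fin (length (elems L))) λ i → Σ (Fin (length (elems L))) λ j →
  lookup (elems L) i ≡ x × lookup (elems L) j ≡ y × toℕ i ≤ toℕ j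

IsLocalRealiser : ∀ {n a b} → List (PLE n a b) → Set
IsLocalRealiser {n} {a} {b} ℒ =
  ∀ (x y : Subset n) → InQ n a b x → InQ n a b y → ¬ (y ⊆ x) →
  Σ (PLE n a b) λ L → L ∈ ℒ × x ≤[ L ] y

μ : ∀ {n a b} → List (PLE n a b) → Subset n → ℕ
μ ℒ x = length (filter (λ L → any? (x ≟ˢ_) (elems L)) ℒ)

-- ldim(Q_n^{a,b}) ≤ m  (ldim is the minimum over local realisers of the
-- maximal multiplicity, so this unfolds to: some local realiser has all
-- multiplicities ≤ m).
LdimQ≤ : (n a b m : ℕ) → Set
LdimQ≤ n a b m = Σ (List (PLE n a b)) λ ℒ →
  IsLocalRealiser ℒ × (∀ x → InQ n a b x → μ ℒ x ≤ m)

module Submission where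

-- Call the ℓ-subsets of [n] small and the (n-k)-subsets large.  The local
-- realiser consists of n + 2 partial linear extensions:
--   * ascending  = (all small sets) ++ (all large sets), in a fixed order;
--   * descending = the same two blocks, each listed in reverse order;
--   * separating p, for p ∈ [n]
--                = (large sets avoiding p) ++ (small sets containing p).
-- Two sets of equal size are incomparable unless equal, and a large set is
-- never inside a small one, so each list is a partial linear extension.
-- A pair x ≱ y of equal size, or with x small and y large, is ordered correctly
-- by ascending or descending.  If x is large, y small and y ⊈ x, choose
-- p ∈ y ∖ x; then x precedes y in separating p.  A small x lies in
-- separating p only when p ∈ x, a large x only when p ∉ x, hence every
-- multiplicity is at most 2 + ℓ resp. 2 + k.

open import Defs
open import Data.Nat using (ℕ; _<_; _∸_; _+_; _⊔_; zero; suc; _≤_; z≤n; s≤s; _≟_)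
import Data.Nat.Properties as ℕₚ
open import Data.Empty using (⊥-elim)
open import Data.Fin using (Fin; toℕ) renaming (zero to fzero; suc to fsuc)
open import Data.Fin.Properties using (¬∀⟶∃¬)
open import Data.Fin.Subset
  using (Subset; _⊆_; ∣_∣; inside; outside; ∁) renaming (_∈_ to _∈ₛ_; _∉_ to _∉ₛ_)
open import Data.Fin.Subset.Properties
  using (_∈?_; _⊆?_; ⊆-antisym; ⊆-reflexive; p⊂q⇒∣p∣<∣q∣; p⊆q⇒∣p∣≤∣q∣; drop-there; ∣p∣≤∣x∷p∣; x∉p⇒x∈∁p; ∣∁p∣≡n∸∣p∣)
open import Data.Vec as Vec using ([]; _∷_)
open import Data.Vec.Properties using (∷-injectiveʳ)
open import Data.List using (List; []; _∷_; _++_; length; lookup; filter; tabulate; map; reverse; [_])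
open import Data.List.Properties using (unfold-reverse)
open import Data.List.Relation.Unary.All as All using (All; []; _∷_)
open import Data.List.Relation.Unary.Any as Any using (here; there; any?)
open import Data.List.Relation.Unary.Any.Properties using (reverse⁺; reverse⁻; lookup-index)
open import Data.List.Relation.Unary.AllPairs as AllPairs using (AllPairs; []; _∷_)
import Data.List.Relation.Unary.AllPairs.Properties as AllPairsₚ
open import Data.List.Relation.Unary.Unique.Propositional using (Unique)
import Data.List.Relation.Unary.Unique.Propositional.Properties as Uniqueₚ
open import Data.List.Relation.Binary.Permutation.Propositional using (↭-sym; ↭⇒↭ₛ)
open import Data.List.Relation.Binary.Permutation.Propositional.Properties using (↭-reverse)
import Data.List.Relation.Binary.Permutation.Setoid.Properties as Permutationₚ
open import Data.List.Membership.Propositional using (_∈_)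
open import Data.List.Membership.Propositional.Properties
  using (∈-map⁺; ∈-map⁻; ∈-++⁺ˡ; ∈-++⁺ʳ; ∈-++⁻; ∈-filter⁺; ∈-filter⁻; ∈-tabulate⁺; ∈-lookup)
open import Data.Product using (Σ; ∃; _×_; _,_; proj₁; proj₂)
open import Data.Sum using (_⊎_; inj₁; inj₂)
open import Function using (_∘_)
open import Relation.Binary.PropositionalEquality using (_≡_; _≢_; refl; sym; trans; subst₂; cong; setoid; module ≡-Reasoning)
open import Relation.Nullary using (¬_; yes; no; ¬?)
open import Relation.Nullary.Decidable using (_→-dec_)
open import Relation.Unary using (Decidable)

private
  variable
    A : Set
    n : ℕ

allSubsets : ∀ n → List (Subset n)
allSubsets zero = [ [] ]
allSubsets (suc n) = map (outside ∷_) (allSubsets n) ++ map (inside ∷_) (allSubsets n)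

∈-allSubsets : (s : Subset n) → s ∈ allSubsets n
∈-allSubsets [] = here refl
∈-allSubsets {suc n} (outside ∷ s) = ∈-++⁺ˡ (∈-map⁺ (outside ∷_) (∈-allSubsets s))
∈-allSubsets {suc n} (inside ∷ s) =
  ∈-++⁺ʳ (map (outside ∷_) (allSubsets n)) (∈-map⁺ (inside ∷_) (∈-allSubsets s))

allSubsets-unique : ∀ n → Unique (allSubsets n)
allSubsets-unique zero = [] ∷ []
allSubsets-unique (suc n) =
  Uniqueₚ.++⁺ (Uniqueₚ.map⁺ ∷-injectiveʳ (allSubsets-unique n))
              (Uniqueₚ.map⁺ ∷-injectiveʳ (allSubsets-unique n)) halves-disjoint
  where
  halves-disjoint : ∀ {v} → ¬ (v ∈ map (outside ∷_) (allSubsets n) × v ∈ map (inside ∷_) (allSubsets n))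
  halves-disjoint (v∈out , v∈in) with ∈-map⁻ (outside ∷_) v∈out | ∈-map⁻ (inside ∷_) v∈in
  ... | _ , _ , refl | _ , _ , ()

⊈⇒witness : {x y : Subset n} → ¬ (y ⊆ x) → ∃ λ p → p ∈ₛ y × p ∉ₛ x
⊈⇒witness {n} {x} {y} y⊈x
  with p , ¬[p∈y⇒p∈x] ← ¬∀⟶∃¬ n (λ p → p ∈ₛ y → p ∈ₛ x) (λ p → (p ∈? y) →-dec (p ∈? x))
                               (λ incl → y⊈x (λ {p} → incl p))
  with p ∈? y
... | yes p∈y = p , p∈y , λ p∈x → ¬[p∈y⇒p∈x] (λ _ → p∈x)
... | no  p∉y = ⊥-elim (¬[p∈y⇒p∈x] (⊥-elim ∘ p∉y))

⊆-size-antisym : {x y : Subset n} → y ⊆ x → ∣ y ∣ ≡ ∣ x ∣ → y ≡ x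
⊆-size-antisym {x = x} {y} y⊆x ∣y∣≡∣x∣ with x ⊆? y
... | yes x⊆y = ⊆-antisym y⊆x x⊆y
... | no  x⊈y with p , p∈x , p∉y ← ⊈⇒witness x⊈y =
  ⊥-elim (ℕₚ.<⇒≢ (p⊂q⇒∣p∣<∣q∣ (y⊆x , p , p∈x , p∉y)) ∣y∣≡∣x∣)

count-tabulate≤ : {P : A → Set} (P? : Decidable P) (f : Fin n → A) (x : Subset n) →
                  (∀ p → P (f p) → p ∈ₛ x) → length (filter P? (tabulate f)) ≤ ∣ x ∣
count-tabulate≤ {n = zero} P? f [] only-x = z≤n
count-tabulate≤ {n = suc n} P? f (b ∷ x) only-x
  with rest ← count-tabulate≤ P? (f ∘ fsuc) x (λ p → drop-there ∘ only-x (fsuc p))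
  with P? (f fzero)
... | yes Pf0 with Vec.here ← only-x fzero Pf0 = s≤s rest
... | no _ = ℕₚ.≤-trans rest (∣p∣≤∣x∷p∣ b x)

length-filter-∷ : {P : A → Set} (P? : Decidable P) (a : A) (l : List A) →
                  length (filter P? (a ∷ l)) ≤ suc (length (filter P? l))
length-filter-∷ P? a l with P? a
... | yes _ = ℕₚ.≤-refl
... | no  _ = ℕₚ.n≤1+n _

Compatible : List (Subset n) → Set
Compatible = AllPairs (λ x y → ¬ (y ⊆ x))

sameSize⇒compatible : {c : ℕ} {l : List (Subset n)} →
                      (∀ {x} → x ∈ l → ∣ x ∣ ≡ c) → Unique l → Compatible l
sameSize⇒compatible size [] = []
sameSize⇒compatible {l = x ∷ l} size (x∉l ∷ unique) =
  All.tabulate later⊈x ∷ sameSize⇒compatible (size ∘ there) unique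
  where
  later⊈x : ∀ {y} → y ∈ l → ¬ (y ⊆ x)
  later⊈x y∈l y⊆x = All.lookup x∉l y∈l (sym (⊆-size-antisym y⊆x (trans (size (there y∈l)) (sym (size (here refl))))))

compatible-++ : {l r : List (Subset n)} → Compatible l → Compatible r →
                (∀ {x y} → x ∈ l → y ∈ r → ¬ (y ⊆ x)) → Compatible (l ++ r)
compatible-++ cl cr cross = AllPairsₚ.++⁺ cl cr (All.tabulate λ x∈l → All.tabulate (cross x∈l))

compatible⇒monotone : {l : List (Subset n)} → Compatible l →
                      ∀ (i j : Fin (length l)) → lookup l i ⊆ lookup l j → toℕ i ≤ toℕ j
compatible⇒monotone (_ ∷ _) fzero j _ = z≤n
compatible⇒monotone (x⊈ ∷ _) (fsuc i) fzero li⊆x = ⊥-elim (All.lookup x⊈ (∈-lookup i) li⊆x)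
compatible⇒monotone (_ ∷ cl) (fsuc i) (fsuc j) li⊆lj = s≤s (compatible⇒monotone cl i j li⊆lj)

compatible⇒PLE : ∀ {a b} (l : List (Subset n)) → (∀ {x} → x ∈ l → InQ n a b x) → Compatible l → PLE n a b
compatible⇒PLE l in-Q cl = record
  { elems    = l
  ; inQ      = All.tabulate in-Q
  ; distinct = AllPairs.map (λ y⊈x x≡y → y⊈x (⊆-reflexive (sym x≡y))) cl
  ; monotone = compatible⇒monotone cl
  }

data Before {A : Set} (x y : A) : List A → Set where
  at-head : ∀ {l} → y ∈ x ∷ l → Before x y (x ∷ l)
  later   : ∀ {z l} → Before x y l → Before x y (z ∷ l)

Before⇒≤[] : ∀ {a b} {L : PLE n a b} {x y : Subset n} → Before x y (elems L) → x ≤[ L ] y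
Before⇒≤[] = positions
  where
  positions : {x y : A} {l : List A} → Before x y l →
    Σ (Fin (length l)) λ i → Σ (Fin (length l)) λ j → lookup l i ≡ x × lookup l j ≡ y × toℕ i ≤ toℕ j
  positions (at-head y∈l) = fzero , Any.index y∈l , refl , sym (lookup-index y∈l) , z≤n
  positions (later b) with i , j , li≡x , lj≡y , i≤j ← positions b = fsuc i , fsuc j , li≡x , lj≡y , s≤s i≤j

Before-++ˡ : {x y : A} {l r : List A} → Before x y l → Before x y (l ++ r)
Before-++ˡ (at-head (here refl)) = at-head (here refl)
Before-++ˡ (at-head (there y∈l)) = at-head (there (∈-++⁺ˡ y∈l))
Before-++ˡ (later b) = later (Before-++ˡ b)

Before-++ʳ : {x y : A} (l : List A) {r : List A} → Before x y r → Before x y (l ++ r)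
Before-++ʳ [] b = b
Before-++ʳ (_ ∷ l) b = later (Before-++ʳ l b)

Before-across : {x y : A} {l r : List A} → x ∈ l → y ∈ r → Before x y (l ++ r)
Before-across {l = _ ∷ l} (here refl) y∈r = at-head (there (∈-++⁺ʳ l y∈r))
Before-across (there x∈l) y∈r = later (Before-across x∈l y∈r)

Before-total : {x y : A} {l : List A} → x ∈ l → y ∈ l → Before x y l ⊎ Before y x l
Before-total (here refl) y∈l = inj₁ (at-head y∈l)
Before-total (there x∈l) (here refl) = inj₂ (at-head (there x∈l))
Before-total (there x∈l) (there y∈l) with Before-total x∈l y∈l
... | inj₁ b = inj₁ (later b)
... | inj₂ b = inj₂ (later b)

Before-reverse : {x y : A} {l : List A} → Before y x l → Before x y (reverse l)
Before-reverse {l = z ∷ l} b rewrite unfold-reverse z l with b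
... | at-head (here refl) = Before-++ʳ (reverse l) (at-head (here refl))
... | at-head (there x∈l) = Before-across (reverse⁺ x∈l) (here refl)
... | later b′ = Before-++ˡ (Before-reverse b′)

module Realiser (n ℓ k : ℕ) (ℓ<n∸k : ℓ < n ∸ k) where
  open Permutationₚ (setoid (Subset n)) using (Unique-resp-↭)

  m : ℕ
  m = n ∸ k

  Q : Subset n → Set
  Q = InQ n ℓ m

  small : List (Subset n)
  small = filter (λ s → ∣ s ∣ ≟ ℓ) (allSubsets n)

  large : List (Subset n)
  large = filter (λ s → ∣ s ∣ ≟ m) (allSubsets n)

  largeAvoiding : Fin n → List (Subset n)
  largeAvoiding p = filter (λ s → ¬? (p ∈? s)) large

  smallContaining : Fin n → List (Subset n)
  smallContaining p = filter (p ∈?_) small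

  small-size : ∀ {x} → x ∈ small → ∣ x ∣ ≡ ℓ
  small-size = proj₂ ∘ ∈-filter⁻ (λ s → ∣ s ∣ ≟ ℓ) {xs = allSubsets n}

  large-size : ∀ {x} → x ∈ large → ∣ x ∣ ≡ m
  large-size = proj₂ ∘ ∈-filter⁻ (λ s → ∣ s ∣ ≟ m) {xs = allSubsets n}

  ∈-small : ∀ {x} → ∣ x ∣ ≡ ℓ → x ∈ small
  ∈-small {x} = ∈-filter⁺ (λ s → ∣ s ∣ ≟ ℓ) (∈-allSubsets x)

  ∈-large : ∀ {x} → ∣ x ∣ ≡ m → x ∈ large
  ∈-large {x} = ∈-filter⁺ (λ s → ∣ s ∣ ≟ m) (∈-allSubsets x)

  ∈-largeAvoiding⁻ : ∀ {p x} → x ∈ largeAvoiding p → x ∈ large × p ∉ₛ x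
  ∈-largeAvoiding⁻ {p} = ∈-filter⁻ (λ s → ¬? (p ∈? s))

  ∈-smallContaining⁻ : ∀ {p x} → x ∈ smallContaining p → x ∈ small × p ∈ₛ x
  ∈-smallContaining⁻ {p} = ∈-filter⁻ (p ∈?_)

  small≢large : ∀ {x : Subset n} → ∣ x ∣ ≡ ℓ → ∣ x ∣ ≢ m
  small≢large ∣x∣≡ℓ ∣x∣≡m = ℕₚ.<⇒≢ ℓ<n∸k (trans (sym ∣x∣≡ℓ) ∣x∣≡m)

  large⊈small : ∀ {x y : Subset n} → ∣ x ∣ ≡ ℓ → ∣ y ∣ ≡ m → ¬ (y ⊆ x)
  large⊈small ∣x∣≡ℓ ∣y∣≡m y⊆x = ℕₚ.<⇒≱ ℓ<n∸k (subst₂ _≤_ ∣y∣≡m ∣x∣≡ℓ (p⊆q⇒∣p∣≤∣q∣ y⊆x))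

  smallThenLarge : (s l : List (Subset n)) → (∀ {x} → x ∈ s → x ∈ small) → Unique s →
                   (∀ {x} → x ∈ l → x ∈ large) → Unique l → PLE n ℓ m
  smallThenLarge s l s⊆small s-unique l⊆large l-unique = compatible⇒PLE (s ++ l) in-Q compat
    where
    in-Q : ∀ {x} → x ∈ s ++ l → Q x
    in-Q x∈ with ∈-++⁻ s x∈
    ... | inj₁ x∈s = inj₁ (small-size (s⊆small x∈s))
    ... | inj₂ x∈l = inj₂ (large-size (l⊆large x∈l))
    compat : Compatible (s ++ l)
    compat = compatible-++ (sameSize⇒compatible (small-size ∘ s⊆small) s-unique)
                           (sameSize⇒compatible (large-size ∘ l⊆large) l-unique)
                           (λ x∈s y∈l → large⊈small (small-size (s⊆small x∈s)) (large-size (l⊆large y∈l)))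

  small-unique : Unique small
  small-unique = Uniqueₚ.filter⁺ _ (allSubsets-unique n)

  large-unique : Unique large
  large-unique = Uniqueₚ.filter⁺ _ (allSubsets-unique n)

  unique-reverse : {l : List (Subset n)} → Unique l → Unique (reverse l)
  unique-reverse {l} = Unique-resp-↭ (↭⇒↭ₛ (↭-sym (↭-reverse l)))

  ascending : PLE n ℓ m
  ascending = smallThenLarge small large (λ x∈ → x∈) small-unique (λ x∈ → x∈) large-unique

  -- Reversing both blocks orders each pair of equal-size sets the other way.
  descending : PLE n ℓ m
  descending = smallThenLarge (reverse small) (reverse large)
                 reverse⁻ (unique-reverse small-unique) reverse⁻ (unique-reverse large-unique)

  separating : Fin n → PLE n ℓ m
  separating p = compatible⇒PLE (largeAvoiding p ++ smallContaining p) in-Q compat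
    where
    in-Q : ∀ {x} → x ∈ largeAvoiding p ++ smallContaining p → Q x
    in-Q x∈ with ∈-++⁻ (largeAvoiding p) x∈
    ... | inj₁ x∈lA = inj₂ (large-size (proj₁ (∈-largeAvoiding⁻ x∈lA)))
    ... | inj₂ x∈sC = inj₁ (small-size (proj₁ (∈-smallContaining⁻ x∈sC)))
    compat : Compatible (largeAvoiding p ++ smallContaining p)
    compat = compatible-++
      (sameSize⇒compatible (large-size ∘ proj₁ ∘ ∈-largeAvoiding⁻) (Uniqueₚ.filter⁺ _ large-unique))
      (sameSize⇒compatible (small-size ∘ proj₁ ∘ ∈-smallContaining⁻) (Uniqueₚ.filter⁺ _ small-unique))
      (λ x∈lA y∈sC y⊆x → proj₂ (∈-largeAvoiding⁻ x∈lA) (y⊆x (proj₂ (∈-smallContaining⁻ y∈sC))))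

  realiser : List (PLE n ℓ m)
  realiser = ascending ∷ descending ∷ tabulate separating

  realises : IsLocalRealiser realiser
  realises x y (inj₁ ∣x∣≡ℓ) (inj₁ ∣y∣≡ℓ) _ with Before-total (∈-small ∣x∣≡ℓ) (∈-small ∣y∣≡ℓ)
  ... | inj₁ x≺y = ascending , here refl , Before⇒≤[] {L = ascending} (Before-++ˡ x≺y)
  ... | inj₂ y≺x = descending , there (here refl) , Before⇒≤[] {L = descending} (Before-++ˡ (Before-reverse y≺x))
  realises x y (inj₁ ∣x∣≡ℓ) (inj₂ ∣y∣≡m) _ =
    ascending , here refl , Before⇒≤[] {L = ascending} (Before-across (∈-small ∣x∣≡ℓ) (∈-large ∣y∣≡m))
  realises x y (inj₂ ∣x∣≡m) (inj₂ ∣y∣≡m) _ with Before-total (∈-large ∣x∣≡m) (∈-large ∣y∣≡m)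
  ... | inj₁ x≺y = ascending , here refl , Before⇒≤[] {L = ascending} (Before-++ʳ small x≺y)
  ... | inj₂ y≺x = descending , there (here refl) ,
                   Before⇒≤[] {L = descending} (Before-++ʳ (reverse small) (Before-reverse y≺x))
  realises x y (inj₂ ∣x∣≡m) (inj₁ ∣y∣≡ℓ) y⊈x with p , p∈y , p∉x ← ⊈⇒witness y⊈x =
    separating p , there (there (∈-tabulate⁺ p)) ,
    Before⇒≤[] {L = separating p} (Before-across (∈-filter⁺ (λ s → ¬? (p ∈? s)) (∈-large ∣x∣≡m) p∉x)
                                                  (∈-filter⁺ (p ∈?_) (∈-small ∣y∣≡ℓ) p∈y))

  separating-small : ∀ {p x} → x ∈ elems (separating p) → ∣ x ∣ ≡ ℓ → p ∈ₛ x
  separating-small {p} {x} x∈ ∣x∣≡ℓ with ∈-++⁻ (largeAvoiding p) x∈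
  ... | inj₁ x∈lA = ⊥-elim (small≢large {x} ∣x∣≡ℓ (large-size (proj₁ (∈-largeAvoiding⁻ x∈lA))))
  ... | inj₂ x∈sC = proj₂ (∈-smallContaining⁻ x∈sC)

  separating-large : ∀ {p x} → x ∈ elems (separating p) → ∣ x ∣ ≡ m → p ∈ₛ ∁ x
  separating-large {p} {x} x∈ ∣x∣≡m with ∈-++⁻ (largeAvoiding p) x∈
  ... | inj₁ x∈lA = x∉p⇒x∈∁p (proj₂ (∈-largeAvoiding⁻ x∈lA))
  ... | inj₂ x∈sC = ⊥-elim (small≢large {x} (small-size (proj₁ (∈-smallContaining⁻ x∈sC))) ∣x∣≡m)

  complement-size : ∀ {x : Subset n} → ∣ x ∣ ≡ m → ∣ ∁ x ∣ ≡ k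
  complement-size {x} ∣x∣≡m = begin
    ∣ ∁ x ∣      ≡⟨ ∣∁p∣≡n∸∣p∣ x ⟩
    n ∸ ∣ x ∣    ≡⟨ cong (n ∸_) ∣x∣≡m ⟩
    n ∸ (n ∸ k)  ≡⟨ ℕₚ.m∸[m∸n]≡n k≤n ⟩
    k            ∎
    where
    open ≡-Reasoning
    k≤n : k ≤ n
    k≤n = ℕₚ.<⇒≤ (ℕₚ.m∸n≢0⇒n<m (ℕₚ.m<n⇒n≢0 ℓ<n∸k))

  -- ascending and descending contribute 2; the separating extensions
  -- containing x are indexed by points of x (small) or of ∁ x (large).
  multiplicity : ∀ x → Q x → μ realiser x ≤ 2 + (ℓ ⊔ k)
  multiplicity x qx =
    ℕₚ.≤-trans (length-filter-∷ contains ascending _)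
      (s≤s (ℕₚ.≤-trans (length-filter-∷ contains descending _) (s≤s (separating-count qx))))
    where
    contains : Decidable (λ (L : PLE n ℓ m) → x ∈ elems L)
    contains L = any? (x ≟ˢ_) (elems L)
    separating-count : Q x → length (filter contains (tabulate separating)) ≤ ℓ ⊔ k
    separating-count (inj₁ ∣x∣≡ℓ) = ℕₚ.≤-trans
      (count-tabulate≤ contains separating x (λ p x∈ → separating-small x∈ ∣x∣≡ℓ))
      (ℕₚ.≤-trans (ℕₚ.≤-reflexive ∣x∣≡ℓ) (ℕₚ.m≤m⊔n ℓ k))
    separating-count (inj₂ ∣x∣≡m) = ℕₚ.≤-trans
      (count-tabulate≤ contains separating (∁ x) (λ p x∈ → separating-large x∈ ∣x∣≡m))
      (ℕₚ.≤-trans (ℕₚ.≤-reflexive (complement-size {x} ∣x∣≡m)) (ℕₚ.m≤n⊔m ℓ k))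

proposition10 : ∀ (n ℓ k : ℕ) → ℓ < n ∸ k → LdimQ≤ n ℓ (n ∸ k) (2 + (ℓ ⊔ k))
proposition10 n ℓ k ℓ<n∸k = realiser , realises , multiplicity
  where open Realiser n ℓ k ℓ<n∸k
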